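{- Let $Z\in\Omega(\vec{\mathbf{d}})$, $p,q\in\{0,1,2,3\}$, $L\in C(p,q)$, and let $a_1,b_1$ be distinct vertices with $L(a_1,b_1)\neq0$. (i) The number of ordered pairs $(a_2,b_2)$ with $L(a_2,b_2)=1$, $L(a_2,b_1)=0$ and $a_1,b_1,a_2,b_2$ all distinct is at least \[ m-2p+q-\Big(r_{\max}\big(r_{\max}-\zeta^-_{b_1}+2\eta^-_{b_1}+2\big)+\eta^-_{a_1}+\eta^+_{b_1}-2(\zeta^-_{a_1}+\zeta^+_{b_1})+\sum_{y\in\widehat N^-_L(b_1)}(\eta^+_y-2\zeta^+_y)\Big).\] (ii) Suppose further $a_1,b_1,a_2,b_2$ are distinct with $L(a_2,b_2)=1$; set $\eta^*=\eta^-_{a_1}+\eta^+_{b_1}+\eta^-_{a_2}+\eta^+_{b_2}$ and $\zeta^*=\zeta^-_{a_1}+\zeta^+_{b_1}+\zeta^-_{a_2}+\zeta^+_{b_2}$. The number of ordered pairs $(a_3,b_3)$ with $L(a_3,b_3)=1$, $L(a_1,b_3)=L(a_3,b_2)=0$ and $a_1,b_1,a_2,b_2,a_3,b_3$ all distinct is at least \[ m-2p+q-\Big(r_{\max}\big(2r_{\max}-(\zeta^+_{a_1}+\zeta^-_{b_2})+2(\eta^+_{a_1}+\eta^-_{b_2})+4\big)+\eta^*-2\zeta^*+\sum_{x\in\widehat N^+_L(a_1)}(\eta^-_x-2\zeta^-_x)+\sum_{y\in\widehat N^-_L(b_2)}(\eta^+_y-2\zeta^+_y)\Big).\]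
   Context: $\vec{\mathbf{d}}=((d_1^-,d_1^+),\ldots,(d_n^-,d_n^+))$ is a digraphical directed degree sequence, $m=\sum_jd_j^+=\sum_jd_j^-$, $r_{\max}=\max_j\max(d_j^-,d_j^+)$, and $\Omega(\vec{\mathbf{d}})$ is the set of loopless digraphs without repeated arcs on $[n]$ with these in/out-degrees, identified with 0-1 adjacency matrices. An encoding is an $n\times n$ matrix $L$ with entries in $\{ -1,0,1,2\}$ and zero diagonal, whose $j$-th row sum is $d_j^+$ and $j$-th column sum is $d_j^-$; it is viewed as an arc-labelled digraph with arc $(v,w)$ of label $L(v,w)$ when nonzero. Arcs labelled $2$ (resp. $-1$) are 2-defect (resp. $(-1)$-defect) arcs. $L$ is consistent with $Z$ if every entry of $L+Z$ is in $\{0,1,2\}$. $L$ is valid if it has at most five defect arcs and the labelled digraph of its defect arcs is isomorphic to a labelled subdigraph of one of the following digraphs (named vertices distinct), where $\{\mu,\nu\}=\{ -1,2\}$ and $\{\xi,\omega\}=\{ -1,2\}$ independently, possibly after reversing all arcs: (D1) vertices $c,t,l,b,r,s$, arcs $(c,l){:}\mu,(c,t){:}\mu,(c,b){:}\nu,(r,c){:}\omega,(r,s){:}\xi$; (D2) $(c,l){:}\mu,(c,t){:}\mu,(c,b){:}\nu,(r,c){:}\omega,(r,b){:}\xi$; (D3) $(c,l){:}\nu,(c,t){:}\mu,(c,b){:}\mu,(r,c){:}\omega,(r,b){:}\xi$; (D4) $(c,l){:}\mu,(c,t){:}\mu,(c,b){:}\nu,(b,c){:}\omega,(b,s){:}\xi$;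 (D5) $(c,l){:}\nu,(c,t){:}\mu,(c,b){:}\mu,(b,c){:}\omega,(b,s){:}\xi$; (D6) $(c,l){:}\mu,(c,t){:}\mu,(c,b){:}\nu,(b,c){:}\omega,(b,l){:}\xi$; (D7) $(c,l){:}\nu,(c,t){:}\mu,(c,b){:}\mu,(b,c){:}\omega,(b,l){:}\xi$; (D8) $(c,l){:}\mu,(c,t){:}\nu,(c,b){:}\mu,(b,c){:}\omega,(b,l){:}\xi$. $C(p,q)$ is the set of valid encodings consistent with $Z$ having exactly $p$ 2-defect arcs and exactly $q$ $(-1)$-defect arcs. For a vertex $v$: $\widehat N^+_L(v)=\{w\neq v:L(v,w)\neq0\}$, $\widehat N^-_L(v)=\{w\neq v:L(w,v)\neq0\}$; $\zeta^-_v,\eta^-_v$ are the numbers of 2-defect and $(-1)$-defect arcs with head $v$, and $\zeta^+_v,\eta^+_v$ those with tail $v$. -}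

module Defs where

open import Data.Nat as ℕ using (ℕ; zero; suc; _⊔_)
open import Data.Integer as ℤ using (ℤ; +_; -1ℤ; 0ℤ; 1ℤ)
open import Data.Fin as F using (Fin)
open import Data.Bool using (Bool; true; false; if_then_else_; _∧_; _∨_; not)
open import Data.Product using (Σ; ∃; _×_; _,_)
open import Data.Sum using (_⊎_)
open import Data.List as List using (List; []; _∷_)
open import Data.List.Membership.Propositional using (_∈_)
open import Relation.Binary.PropositionalEquality using (_≡_)
open import Relation.Nullary.Decidable using (⌊_⌋)

sumℕ : ∀ {n} → (Fin n → ℕ) → ℕ
sumℕ {zero}  f = 0
sumℕ {suc n} f = f F.zero ℕ.+ sumℕ (λ i → f (F.suc i))

sumℤ : ∀ {n} → (Fin n → ℤ) → ℤ
sumℤ {zero}  f = 0ℤ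
sumℤ {suc n} f = f F.zero ℤ.+ sumℤ (λ i → f (F.suc i))

maxℕ : ∀ {n} → (Fin n → ℕ) → ℕ
maxℕ {zero}  f = 0
maxℕ {suc n} f = f F.zero ⊔ maxℕ (λ i → f (F.suc i))

count : ∀ {n} → (Fin n → Bool) → ℕ
count P = sumℕ (λ i → if P i then 1 else 0)

countPairs : ∀ {n} → (Fin n → Fin n → Bool) → ℕ
countPairs P = sumℕ (λ i → count (P i))

_=ᶻ_ : ℤ → ℤ → Bool
x =ᶻ y = ⌊ x ℤ.≟ y ⌋

_≠ᶠ_ : ∀ {n} → Fin n → Fin n → Bool
i ≠ᶠ j = not ⌊ i F.≟ j ⌋

freshᵇ : ∀ {n} → Fin n → List (Fin n) → Bool
freshᵇ x [] = true
freshᵇ x (y ∷ ys) = (x ≠ᶠ y) ∧ freshᵇ x ys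

distinctᵇ : ∀ {n} → List (Fin n) → Bool
distinctᵇ [] = true
distinctᵇ (x ∷ xs) = freshᵇ x xs ∧ distinctᵇ xs

2ℤ : ℤ
2ℤ = + 2

record DegSeq (n : ℕ) : Set where
  field
    din  : Fin n → ℕ
    dout : Fin n → ℕ
open DegSeq public

mOf : ∀ {n} → DegSeq n → ℕ
mOf d = sumℕ (dout d)

rmax : ∀ {n} → DegSeq n → ℕ
rmax d = maxℕ (λ j → din d j ⊔ dout d j)

Matrix : ℕ → Set
Matrix n = Fin n → Fin n → ℤ

rowSum : ∀ {n} → Matrix n → Fin n → ℤ
rowSum M j = sumℤ (λ k → M j k)

colSum : ∀ {n} → Matrix n → Fin n → ℤ
colSum M j = sumℤ (λ k → M k j)

InΩ : ∀ {n} → DegSeq n → Matrix n → Set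
InΩ d Z =
  (∀ i j → Z i j ≡ 0ℤ ⊎ Z i j ≡ 1ℤ) ×
  (∀ i → Z i i ≡ 0ℤ) ×
  (∀ j → rowSum Z j ≡ + dout d j) ×
  (∀ j → colSum Z j ≡ + din d j)

IsEncoding : ∀ {n} → DegSeq n → Matrix n → Set
IsEncoding d L =
  (∀ i j → L i j ≡ -1ℤ ⊎ L i j ≡ 0ℤ ⊎ L i j ≡ 1ℤ ⊎ L i j ≡ 2ℤ) ×
  (∀ i → L i i ≡ 0ℤ) ×
  (∀ j → rowSum L j ≡ + dout d j) ×
  (∀ j → colSum L j ≡ + din d j)

Consistent : ∀ {n} → Matrix n → Matrix n → Set
Consistent L Z = ∀ i j →
  L i j ℤ.+ Z i j ≡ 0ℤ ⊎ L i j ℤ.+ Z i j ≡ 1ℤ ⊎ L i j ℤ.+ Z i j ≡ 2ℤ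

IsDefect : ℤ → Set
IsDefect x = x ≡ 2ℤ ⊎ x ≡ -1ℤ

defectᵇ : ℤ → Bool
defectᵇ x = (x =ᶻ 2ℤ) ∨ (x =ᶻ -1ℤ)

nDefect nTwo nMinus : ∀ {n} → Matrix n → ℕ
nDefect L = countPairs (λ i j → defectᵇ (L i j))
nTwo    L = countPairs (λ i j → L i j =ᶻ 2ℤ)
nMinus  L = countPairs (λ i j → L i j =ᶻ -1ℤ)

DefectVertex : ∀ {n} → Matrix n → Fin n → Set
DefectVertex L u = ∃ λ w → IsDefect (L u w) ⊎ IsDefect (L w u)

data DV : Set where
  c t l b r s : DV

data Config : Set where
  D1 D2 D3 D4 D5 D6 D7 D8 : Config

arcs : Config → (μ ν ξ ω : ℤ) → List (DV × DV × ℤ)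
arcs D1 μ ν ξ ω = (c , l , μ) ∷ (c , t , μ) ∷ (c , b , ν) ∷ (r , c , ω) ∷ (r , s , ξ) ∷ []
arcs D2 μ ν ξ ω = (c , l , μ) ∷ (c , t , μ) ∷ (c , b , ν) ∷ (r , c , ω) ∷ (r , b , ξ) ∷ []
arcs D3 μ ν ξ ω = (c , l , ν) ∷ (c , t , μ) ∷ (c , b , μ) ∷ (r , c , ω) ∷ (r , b , ξ) ∷ []
arcs D4 μ ν ξ ω = (c , l , μ) ∷ (c , t , μ) ∷ (c , b , ν) ∷ (b , c , ω) ∷ (b , s , ξ) ∷ []
arcs D5 μ ν ξ ω = (c , l , ν) ∷ (c , t , μ) ∷ (c , b , μ) ∷ (b , c , ω) ∷ (b , s , ξ) ∷ []
arcs D6 μ ν ξ ω = (c , l , μ) ∷ (c , t , μ) ∷ (c , b , ν) ∷ (b , c , ω) ∷ (b , l , ξ) ∷ []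
arcs D7 μ ν ξ ω = (c , l , ν) ∷ (c , t , μ) ∷ (c , b , μ) ∷ (b , c , ω) ∷ (b , l , ξ) ∷ []
arcs D8 μ ν ξ ω = (c , l , μ) ∷ (c , t , ν) ∷ (c , b , μ) ∷ (b , c , ω) ∷ (b , l , ξ) ∷ []

-- the label -1 or 2 selected by a Boolean; {μ,ν} = {lab β, lab (not β)}
lab : Bool → ℤ
lab true  = 2ℤ
lab false = -1ℤ

reverseArc : DV × DV × ℤ → DV × DV × ℤ
reverseArc (x , y , ℓ) = (y , x , ℓ)

template : Config → (β γ rev : Bool) → List (DV × DV × ℤ)
template D β γ false = arcs D (lab β) (lab (not β)) (lab γ) (lab (not γ))
template D β γ true  = List.map reverseArc (arcs D (lab β) (lab (not β)) (lab γ) (lab (not γ)))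

-- L is valid: at most five defect arcs, and the labelled digraph of defect
-- arcs is isomorphic to a labelled subdigraph of some template, i.e. there
-- is a map φ, injective on the vertices of the defect digraph, sending each
-- defect arc (v,w) of label L v w to an arc (φ v, φ w) of the template with
-- the same label.
Valid : ∀ {n} → Matrix n → Set
Valid {n} L =
  nDefect L ℕ.≤ 5 ×
  Σ Config λ D → Σ Bool λ β → Σ Bool λ γ → Σ Bool λ rev → Σ (Fin n → DV) λ φ →
    (∀ u u' → DefectVertex L u → DefectVertex L u' → φ u ≡ φ u' → u ≡ u') ×
    (∀ v w → IsDefect (L v w) → (φ v , φ w , L v w) ∈ template D β γ rev)

InC : ∀ {n} → DegSeq n → Matrix n → ℕ → ℕ → Matrix n → Set
InC d Z p q L =
  IsEncoding d L × Valid L × Consistent L Z × nTwo L ≡ p × nMinus L ≡ q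

ζ⁻ η⁻ ζ⁺ η⁺ : ∀ {n} → Matrix n → Fin n → ℕ
ζ⁻ L v = count (λ u → L u v =ᶻ 2ℤ)
η⁻ L v = count (λ u → L u v =ᶻ -1ℤ)
ζ⁺ L v = count (λ w → L v w =ᶻ 2ℤ)
η⁺ L v = count (λ w → L v w =ᶻ -1ℤ)

inN⁺ inN⁻ : ∀ {n} → Matrix n → Fin n → Fin n → Bool
inN⁺ L v w = (w ≠ᶠ v) ∧ not (L v w =ᶻ 0ℤ)
inN⁻ L v w = (w ≠ᶠ v) ∧ not (L w v =ᶻ 0ℤ)

sumIn : ∀ {n} → Matrix n → Fin n → ℤ
sumIn L v = sumℤ (λ y → if inN⁻ L v y then (+ η⁺ L y) ℤ.- 2ℤ ℤ.* (+ ζ⁺ L y) else 0ℤ)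

sumOut : ∀ {n} → Matrix n → Fin n → ℤ
sumOut L v = sumℤ (λ x → if inN⁺ L v x then (+ η⁻ L x) ℤ.- 2ℤ ℤ.* (+ ζ⁻ L x) else 0ℤ)

boundI : ∀ {n} → DegSeq n → Matrix n → (p q : ℕ) → (a₁ b₁ : Fin n) → ℤ
boundI d L p q a₁ b₁ =
  (+ mOf d) ℤ.- 2ℤ ℤ.* (+ p) ℤ.+ (+ q) ℤ.-
   ( R ℤ.* (R ℤ.- (+ ζ⁻ L b₁) ℤ.+ 2ℤ ℤ.* (+ η⁻ L b₁) ℤ.+ 2ℤ)
     ℤ.+ (+ η⁻ L a₁) ℤ.+ (+ η⁺ L b₁)
     ℤ.- 2ℤ ℤ.* ((+ ζ⁻ L a₁) ℤ.+ (+ ζ⁺ L b₁))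
     ℤ.+ sumIn L b₁ )
  where R = + rmax d

boundII : ∀ {n} → DegSeq n → Matrix n → (p q : ℕ) → (a₁ b₁ a₂ b₂ : Fin n) → ℤ
boundII d L p q a₁ b₁ a₂ b₂ =
  (+ mOf d) ℤ.- 2ℤ ℤ.* (+ p) ℤ.+ (+ q) ℤ.-
   ( R ℤ.* (2ℤ ℤ.* R ℤ.- ((+ ζ⁺ L a₁) ℤ.+ (+ ζ⁻ L b₂))
             ℤ.+ 2ℤ ℤ.* ((+ η⁺ L a₁) ℤ.+ (+ η⁻ L b₂)) ℤ.+ + 4)
     ℤ.+ ηs ℤ.- 2ℤ ℤ.* ζs
     ℤ.+ sumOut L a₁ ℤ.+ sumIn L b₂ )
  where
  R  = + rmax d
  ηs = + (η⁻ L a₁ ℕ.+ η⁺ L b₁ ℕ.+ η⁻ L a₂ ℕ.+ η⁺ L b₂)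
  ζs = + (ζ⁻ L a₁ ℕ.+ ζ⁺ L b₁ ℕ.+ ζ⁻ L a₂ ℕ.+ ζ⁺ L b₂)

countI : ∀ {n} → Matrix n → (a₁ b₁ : Fin n) → ℕ
countI L a₁ b₁ = countPairs (λ a₂ b₂ →
  (L a₂ b₂ =ᶻ 1ℤ) ∧ (L a₂ b₁ =ᶻ 0ℤ) ∧ distinctᵇ (a₁ ∷ b₁ ∷ a₂ ∷ b₂ ∷ []))

countII : ∀ {n} → Matrix n → (a₁ b₁ a₂ b₂ : Fin n) → ℕ
countII L a₁ b₁ a₂ b₂ = countPairs (λ a₃ b₃ →
  (L a₃ b₃ =ᶻ 1ℤ) ∧ (L a₁ b₃ =ᶻ 0ℤ) ∧ (L a₃ b₂ =ᶻ 0ℤ) ∧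
  distinctᵇ (a₁ ∷ b₁ ∷ a₂ ∷ b₂ ∷ a₃ ∷ b₃ ∷ []))

-- Count the arcs of label 1. Because an encoding has the prescribed row and column sums, the
-- 1-arcs leaving a vertex v number d⁺ᵥ − 2ζ⁺ᵥ + η⁺ᵥ, and v has at most d⁺ᵥ − ζ⁺ᵥ + 2η⁺ᵥ
-- out-neighbours (dually for heads); summing over v, L has m − 2p + q arcs of label 1. Every
-- 1-arc that is not counted has its tail at some bᵢ or at an in-neighbour of b₁ (in (ii): of b₂),
-- or its head at some aᵢ or (in (ii)) at an out-neighbour of a₁. With all degrees bounded by
-- r_max each of these classes has at most the corresponding summand of the subtracted term, and
-- the union bound gives both inequalities.

module Submission where

open import Defs
open import Data.Nat using (ℕ; _≤_)
open import Data.Integer as ℤ using (ℤ; +_; 0ℤ; 1ℤ)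
open import Data.Fin using (Fin)
open import Data.List using (_∷_; [])
open import Data.List.Relation.Unary.Unique.Propositional using (Unique)
open import Data.Product using (_×_)
open import Relation.Binary.PropositionalEquality using (_≡_; _≢_)

import Data.Nat as ℕ
import Data.Nat.Properties as ℕP
import Data.Integer.Properties as ℤP
open import Data.Integer using (_+_; _-_; _*_; -_; -1ℤ)
open import Data.Integer.Tactic.RingSolver using (solve-∀)
open import Algebra.Properties.Semiring.Sum ℤP.+-*-semiring
  using (sum; sum-cong-≗; sum-replicate-zero; ∑-distrib-+; ∑-comm; *-distribˡ-sum)
open import Data.Fin using (zero; suc; _≟_)
open import Data.Bool using (Bool; true; false; T; not; _∧_; if_then_else_)
open import Data.Bool.Properties using (T-∧; ∧-identityʳ)
open import Data.Unit using (tt)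
open import Data.Sum using (_⊎_; inj₁; inj₂)
open import Data.Product using (_,_; proj₁; proj₂)
open import Data.List as List using (List)
open import Data.List.Relation.Unary.Any as Any using (Any; here; there)
open import Data.List.Relation.Unary.All using (All; []; _∷_)
open import Data.List.Relation.Unary.AllPairs using ([]; _∷_)
open import Function using (_∘_; Equivalence)
open import Relation.Nullary.Decidable
  using (⌊_⌋; ⌊⌋-map′; yes; no; toWitness; fromWitness; fromWitnessFalse)
open import Relation.Binary.PropositionalEquality
  using (refl; sym; trans; cong; cong₂; subst; module ≡-Reasoning)

𝟙 : Bool → ℤ
𝟙 x = + (if x then 1 else 0)

0≤𝟙 : ∀ x → 0ℤ ℤ.≤ 𝟙 x
0≤𝟙 x = ℤ.+≤+ ℕ.z≤n

𝟙-∧-≤ : ∀ x y → 𝟙 (x ∧ y) ℤ.≤ 𝟙 y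
𝟙-∧-≤ true  y = ℤP.≤-refl
𝟙-∧-≤ false y = 0≤𝟙 y

sumℤ≡sum : ∀ {n} (f : Fin n → ℤ) → sumℤ f ≡ sum f
sumℤ≡sum {ℕ.zero}  f = refl
sumℤ≡sum {ℕ.suc n} f = cong (_+_ (f zero)) (sumℤ≡sum (f ∘ suc))

+sumℕ≡sum : ∀ {n} (f : Fin n → ℕ) → + sumℕ f ≡ sum (λ i → + f i)
+sumℕ≡sum {ℕ.zero}  f = refl
+sumℕ≡sum {ℕ.suc n} f =
  trans (ℤP.pos-+ (f zero) _) (cong (_+_ (+ f zero)) (+sumℕ≡sum (f ∘ suc)))

+count≡sum : ∀ {n} (P : Fin n → Bool) → + count P ≡ sum (𝟙 ∘ P)
+count≡sum P = +sumℕ≡sum (λ i → if P i then 1 else 0)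

sum-mono-≤ : ∀ {n} {f g : Fin n → ℤ} → (∀ i → f i ℤ.≤ g i) → sum f ℤ.≤ sum g
sum-mono-≤ {ℕ.zero}  _   = ℤP.≤-refl
sum-mono-≤ {ℕ.suc n} f≤g = ℤP.+-mono-≤ (f≤g zero) (sum-mono-≤ (f≤g ∘ suc))

∑-delta : ∀ {n} (a : Fin n) (g : Fin n → ℤ) →
  sum (λ i → if ⌊ i ≟ a ⌋ then g i else 0ℤ) ≡ g a
∑-delta {ℕ.suc n} zero g =
  trans (cong (_+_ (g zero)) (sum-replicate-zero n)) (ℤP.+-identityʳ (g zero))
∑-delta (suc a) g = trans (ℤP.+-identityˡ _)
  (trans (sum-cong-≗ (λ i → cong (λ x → if x then g (suc i) else 0ℤ) (⌊⌋-map′ _ _ (i ≟ a))))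
         (∑-delta a (g ∘ suc)))

sum-𝟙-∧ : ∀ {n} x (f : Fin n → Bool) →
  sum (λ j → 𝟙 (x ∧ f j)) ≡ (if x then sum (𝟙 ∘ f) else 0ℤ)
sum-𝟙-∧ true      f = refl
sum-𝟙-∧ {n} false f = sum-replicate-zero n

sum-if-≤ : ∀ {n} (ρ : ℕ) (S : Fin n → Bool) {w e : Fin n → ℤ} {K : ℤ} →
  (∀ i → w i ℤ.≤ + ρ + e i) → sum (𝟙 ∘ S) ℤ.≤ K →
  sum (λ i → if S i then w i else 0ℤ) ℤ.≤ + ρ * K + sum (λ i → if S i then e i else 0ℤ)
sum-if-≤ {n} ρ S {w} {e} {K} w≤ρ+e ∑S≤K = begin
  sum (λ i → if S i then w i else 0ℤ)
    ≤⟨ sum-mono-≤ (λ i → pointwise (S i) (w≤ρ+e i)) ⟩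
  sum (λ i → + ρ * 𝟙 (S i) + eˢ i)   ≡⟨ ∑-distrib-+ (λ i → + ρ * 𝟙 (S i)) eˢ ⟩
  sum (λ i → + ρ * 𝟙 (S i)) + sum eˢ ≡⟨ cong (_+ sum eˢ) (*-distribˡ-sum (+ ρ) (𝟙 ∘ S)) ⟨
  + ρ * sum (𝟙 ∘ S) + sum eˢ         ≤⟨ ℤP.+-monoˡ-≤ (sum eˢ) (ℤP.*-monoˡ-≤-nonNeg (+ ρ) ∑S≤K) ⟩
  + ρ * K + sum eˢ                   ∎
  where
  open ℤP.≤-Reasoning
  eˢ : Fin n → ℤ
  eˢ i = if S i then e i else 0ℤ
  pointwise : ∀ x {u y} → u ℤ.≤ + ρ + y →
    (if x then u else 0ℤ) ℤ.≤ + ρ * 𝟙 x + (if x then y else 0ℤ)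
  pointwise true  {u} {y} u≤ρ+y =
    subst (λ z → u ℤ.≤ z + y) (sym (ℤP.*-identityʳ (+ ρ))) u≤ρ+y
  pointwise false _ =
    ℤP.≤-reflexive (sym (trans (ℤP.+-identityʳ _) (ℤP.*-zeroʳ (+ ρ))))

PairPred : ℕ → Set
PairPred n = Fin n → Fin n → Bool

_∩_ : ∀ {n} → PairPred n → PairPred n → PairPred n
(P ∩ Q) i j = P i j ∧ Q i j

sum² : ∀ {n} → (Fin n → Fin n → ℤ) → ℤ
sum² f = sum (λ i → sum (f i))

sum²-+ : ∀ {n} (f g : Fin n → Fin n → ℤ) → sum² (λ i j → f i j + g i j) ≡ sum² f + sum² g
sum²-+ f g = trans (sum-cong-≗ (λ i → ∑-distrib-+ (f i) (g i)))
                   (∑-distrib-+ (λ i → sum (f i)) (λ i → sum (g i)))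

#[_] : ∀ {n} → PairPred n → ℤ
#[ P ] = sum² (λ i j → 𝟙 (P i j))

+countPairs≡# : ∀ {n} (P : PairPred n) → + countPairs P ≡ #[ P ]
+countPairs≡# P =
  trans (+sumℕ≡sum (λ i → count (P i))) (sum-cong-≗ (λ i → +count≡sum (P i)))

#-transpose : ∀ {n} (P : PairPred n) → #[ P ] ≡ #[ (λ i j → P j i) ]
#-transpose P = ∑-comm (λ i j → 𝟙 (P i j))

#-tail-restricted : ∀ {n} (C : Fin n → Bool) (Q : PairPred n) →
  #[ (λ i j → C i) ∩ Q ] ≡ sum (λ i → if C i then sum (𝟙 ∘ Q i) else 0ℤ)
#-tail-restricted C Q = sum-cong-≗ (λ i → sum-𝟙-∧ (C i) (Q i))

#-tail-at : ∀ {n} (v : Fin n) (Q : PairPred n) →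
  #[ (λ i j → ⌊ i ≟ v ⌋) ∩ Q ] ≡ sum (𝟙 ∘ Q v)
#-tail-at v Q =
  trans (#-tail-restricted (λ i → ⌊ i ≟ v ⌋) Q) (∑-delta v (λ i → sum (𝟙 ∘ Q i)))

sumᴸ : List ℤ → ℤ
sumᴸ = List.foldr _+_ 0ℤ

sum²-sumᴸ : ∀ {n} {A : Set} (g : A → Fin n → Fin n → ℤ) (xs : List A) →
  sum² (λ i j → sumᴸ (List.map (λ x → g x i j) xs)) ≡ sumᴸ (List.map (λ x → sum² (g x)) xs)
sum²-sumᴸ {n} g [] =
  trans (sum-cong-≗ {n} {x = λ _ → sum {n} (λ _ → 0ℤ)} {y = λ _ → 0ℤ}
                    (λ _ → sum-replicate-zero n))
        (sum-replicate-zero n)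
sum²-sumᴸ g (x ∷ xs) = trans (sum²-+ (g x) _) (cong (_+_ (sum² (g x))) (sum²-sumᴸ g xs))

0≤sumᴸ𝟙 : ∀ {A : Set} (f : A → Bool) xs → 0ℤ ℤ.≤ sumᴸ (List.map (𝟙 ∘ f) xs)
0≤sumᴸ𝟙 f []       = ℤP.≤-refl
0≤sumᴸ𝟙 f (x ∷ xs) = ℤP.+-mono-≤ (0≤𝟙 (f x)) (0≤sumᴸ𝟙 f xs)

1≤sumᴸ𝟙 : ∀ {A : Set} (f : A → Bool) {xs} → Any (T ∘ f) xs →
  1ℤ ℤ.≤ sumᴸ (List.map (𝟙 ∘ f) xs)
1≤sumᴸ𝟙 f {x ∷ xs} (here fx) with f x | fx
... | true  | _  = ℤP.+-monoʳ-≤ 1ℤ (0≤sumᴸ𝟙 f xs)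
... | false | ()
1≤sumᴸ𝟙 f {x ∷ xs} (there any) = ℤP.+-mono-≤ (0≤𝟙 (f x)) (1≤sumᴸ𝟙 f any)

𝟙-cover : ∀ {A : Set} (f : A → Bool) (q p : Bool) (xs : List A) →
  (T q → T p ⊎ Any (T ∘ f) xs) → 𝟙 q ℤ.≤ 𝟙 p + sumᴸ (List.map (λ x → 𝟙 (f x ∧ q)) xs)
𝟙-cover f false p xs _ = ℤP.+-mono-≤ (0≤𝟙 p) (0≤sumᴸ𝟙 (λ x → f x ∧ false) xs)
𝟙-cover f true true xs _ = ℤP.+-monoʳ-≤ 1ℤ (0≤sumᴸ𝟙 (λ x → f x ∧ true) xs)
𝟙-cover f true false xs covered with covered tt
... | inj₂ any = ℤP.≤-trans
  (1≤sumᴸ𝟙 (λ x → f x ∧ true) (Any.map (subst T (sym (∧-identityʳ _))) any))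
  (ℤP.≤-reflexive (sym (ℤP.+-identityˡ _)))

#-cover : ∀ {n} (P Q : PairPred n) (Cs : List (PairPred n)) →
  (∀ i j → T (Q i j) → T (P i j) ⊎ Any (λ C → T (C i j)) Cs) →
  #[ Q ] ℤ.≤ + countPairs P + sumᴸ (List.map (λ C → #[ C ∩ Q ]) Cs)
#-cover {n} P Q Cs covered = begin
  #[ Q ]
    ≤⟨ sum-mono-≤ (λ i → sum-mono-≤ (λ j →
         𝟙-cover (λ C → C i j) (Q i j) (P i j) Cs (covered i j))) ⟩
  sum² (λ i j → 𝟙 (P i j) + excluded i j)
    ≡⟨ sum²-+ (λ i j → 𝟙 (P i j)) excluded ⟩
  #[ P ] + sum² excluded
    ≡⟨ cong₂ _+_ (sym (+countPairs≡# P)) (sum²-sumᴸ (λ C i j → 𝟙 (C i j ∧ Q i j)) Cs) ⟩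
  + countPairs P + sumᴸ (List.map (λ C → #[ C ∩ Q ]) Cs) ∎
  where
  open ℤP.≤-Reasoning
  excluded : Fin n → Fin n → ℤ
  excluded i j = sumᴸ (List.map (λ C → 𝟙 (C i j ∧ Q i j)) Cs)

freshᵇ-All : ∀ {n} {x : Fin n} {xs} → All (x ≢_) xs → T (freshᵇ x xs)
freshᵇ-All []           = tt
freshᵇ-All {x = x} {y ∷ _} (x≢y ∷ x∉ys) =
  Equivalence.from (T-∧ {x ≠ᶠ y}) (fromWitnessFalse x≢y , freshᵇ-All x∉ys)

distinctᵇ-Unique : ∀ {n} {xs : List (Fin n)} → Unique xs → T (distinctᵇ xs)
distinctᵇ-Unique []           = tt
distinctᵇ-Unique {xs = x ∷ xs} (x∉xs ∷ uxs) =
  Equivalence.from (T-∧ {freshᵇ x xs}) (freshᵇ-All x∉xs , distinctᵇ-Unique uxs)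

[u+v]-v≡u : ∀ u v → (u + v) - v ≡ u
[u+v]-v≡u = solve-∀

balance⇒≤ : ∀ {a x y e ρ : ℤ} → a + x ≡ y + e → y ℤ.≤ ρ → a ℤ.≤ ρ + (e - x)
balance⇒≤ {a} {x} {y} {e} {ρ} a+x≡y+e y≤ρ = begin
  a              ≡⟨ [u+v]-v≡u a x ⟨
  (a + x) - x    ≡⟨ cong (_- x) a+x≡y+e ⟩
  (y + e) - x    ≤⟨ ℤP.+-monoˡ-≤ (- x) (ℤP.+-monoˡ-≤ e y≤ρ) ⟩
  (ρ + e) - x    ≡⟨ ℤP.+-assoc ρ e (- x) ⟩
  ρ + (e - x)    ∎
  where open ℤP.≤-Reasoning

count-lower-bound : ∀ {ones m p q N S X : ℤ} →
  ones + 2ℤ * p ≡ m + q → ones ℤ.≤ N + S → S ℤ.≤ X → m - 2ℤ * p + q - X ℤ.≤ N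
count-lower-bound {ones} {m} {p} {q} {N} {S} {X} balance ones≤N+S S≤X = begin
  m - 2ℤ * p + q - X             ≡⟨ cong (_- X) (regroup m p q) ⟩
  (m + q) - 2ℤ * p - X           ≡⟨ cong (λ z → z - 2ℤ * p - X) balance ⟨
  (ones + 2ℤ * p) - 2ℤ * p - X   ≡⟨ cong (_- X) ([u+v]-v≡u ones (2ℤ * p)) ⟩
  ones - X                       ≤⟨ ℤP.+-monoˡ-≤ (- X) ones≤N+S ⟩
  (N + S) - X                    ≤⟨ ℤP.+-monoˡ-≤ (- X) (ℤP.+-monoʳ-≤ N S≤X) ⟩
  (N + X) - X                    ≡⟨ [u+v]-v≡u N X ⟩
  N                              ∎
  where
  open ℤP.≤-Reasoning
  regroup : ∀ u v w → u - 2ℤ * v + w ≡ (u + w) - 2ℤ * v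
  regroup = solve-∀

-- ζ⁺, η⁺, inN⁺ and sumOut of the transpose are definitionally ζ⁻, η⁻, inN⁻ and sumIn, so each
-- column statement below is the row statement for the transposed encoding.
transpose : ∀ {n} → Matrix n → Matrix n
transpose L i j = L j i

swapDegrees : ∀ {n} → DegSeq n → DegSeq n
swapDegrees d = record { din = dout d ; dout = din d }

IsEncoding-transpose : ∀ {n} {d : DegSeq n} {L : Matrix n} →
  IsEncoding d L → IsEncoding (swapDegrees d) (transpose L)
IsEncoding-transpose (labels , diag , rows , cols) = (λ i j → labels j i) , diag , cols , rows

Label : ℤ → Set
Label x = x ≡ -1ℤ ⊎ x ≡ 0ℤ ⊎ x ≡ 1ℤ ⊎ x ≡ 2ℤ

-- The negative terms are moved across, so that summing these over a row needs only additivity.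
ones-balance : ∀ {x} → Label x → 𝟙 (x =ᶻ 1ℤ) + 2ℤ * 𝟙 (x =ᶻ 2ℤ) ≡ x + 𝟙 (x =ᶻ -1ℤ)
ones-balance (inj₁ refl)               = refl
ones-balance (inj₂ (inj₁ refl))        = refl
ones-balance (inj₂ (inj₂ (inj₁ refl))) = refl
ones-balance (inj₂ (inj₂ (inj₂ refl))) = refl

nonzero-balance : ∀ {x} → Label x → 𝟙 (not (x =ᶻ 0ℤ)) + 𝟙 (x =ᶻ 2ℤ) ≡ x + 2ℤ * 𝟙 (x =ᶻ -1ℤ)
nonzero-balance (inj₁ refl)               = refl
nonzero-balance (inj₂ (inj₁ refl))        = refl
nonzero-balance (inj₂ (inj₂ (inj₁ refl))) = refl
nonzero-balance (inj₂ (inj₂ (inj₂ refl))) = refl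

isOne : ∀ {n} → Matrix n → PairPred n
isOne L i j = L i j =ᶻ 1ℤ

onesFrom : ∀ {n} → Matrix n → Fin n → ℤ
onesFrom L v = sum (𝟙 ∘ isOne L v)

module RowSums {n} {d : DegSeq n} {L : Matrix n} (enc : IsEncoding d L) where
  open ≡-Reasoning

  row-balance : (A : ℤ → Bool) (g h : ℤ → ℤ) → (∀ {x} → Label x → 𝟙 (A x) + g x ≡ x + h x) →
    ∀ v → sum (𝟙 ∘ A ∘ L v) + sum (g ∘ L v) ≡ + dout d v + sum (h ∘ L v)
  row-balance A g h pointwise v = begin
    sum (𝟙 ∘ A ∘ L v) + sum (g ∘ L v)     ≡⟨ ∑-distrib-+ (𝟙 ∘ A ∘ L v) (g ∘ L v) ⟨
    sum (λ w → 𝟙 (A (L v w)) + g (L v w)) ≡⟨ sum-cong-≗ (λ w → pointwise (labels v w)) ⟩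
    sum (λ w → L v w + h (L v w))         ≡⟨ ∑-distrib-+ (L v) (h ∘ L v) ⟩
    sum (L v) + sum (h ∘ L v)             ≡⟨ cong (_+ sum (h ∘ L v)) rowSum≡dout ⟩
    + dout d v + sum (h ∘ L v)            ∎
    where
    labels : ∀ v w → Label (L v w)
    labels = proj₁ enc
    rowSum≡dout : sum (L v) ≡ + dout d v
    rowSum≡dout = trans (sym (sumℤ≡sum (L v))) (proj₁ (proj₂ (proj₂ enc)) v)

  onesFrom-balance : ∀ v → onesFrom L v + 2ℤ * + ζ⁺ L v ≡ + dout d v + + η⁺ L v
  onesFrom-balance v = begin
    onesFrom L v + 2ℤ * + ζ⁺ L v
      ≡⟨ cong (λ z → onesFrom L v + 2ℤ * z) (+count≡sum isTwo) ⟩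
    onesFrom L v + 2ℤ * sum (𝟙 ∘ isTwo)
      ≡⟨ cong (_+_ (onesFrom L v)) (*-distribˡ-sum 2ℤ (𝟙 ∘ isTwo)) ⟩
    onesFrom L v + sum (λ w → 2ℤ * 𝟙 (isTwo w))
      ≡⟨ row-balance (_=ᶻ 1ℤ) (λ x → 2ℤ * 𝟙 (x =ᶻ 2ℤ)) (λ x → 𝟙 (x =ᶻ -1ℤ)) ones-balance v ⟩
    + dout d v + sum (𝟙 ∘ isMinus)
      ≡⟨ cong (_+_ (+ dout d v)) (+count≡sum isMinus) ⟨
    + dout d v + + η⁺ L v
      ∎
    where
    isTwo isMinus : Fin n → Bool
    isTwo w = L v w =ᶻ 2ℤ
    isMinus w = L v w =ᶻ -1ℤ

  nonzeroFrom-balance : ∀ v →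
    sum (λ w → 𝟙 (not (L v w =ᶻ 0ℤ))) + + ζ⁺ L v ≡ + dout d v + 2ℤ * + η⁺ L v
  nonzeroFrom-balance v = begin
    sum (𝟙 ∘ isNonzero) + + ζ⁺ L v
      ≡⟨ cong (_+_ (sum (𝟙 ∘ isNonzero))) (+count≡sum isTwo) ⟩
    sum (𝟙 ∘ isNonzero) + sum (𝟙 ∘ isTwo)
      ≡⟨ row-balance (λ x → not (x =ᶻ 0ℤ)) (λ x → 𝟙 (x =ᶻ 2ℤ)) (λ x → 2ℤ * 𝟙 (x =ᶻ -1ℤ))
                     nonzero-balance v ⟩
    + dout d v + sum (λ w → 2ℤ * 𝟙 (isMinus w))
      ≡⟨ cong (_+_ (+ dout d v)) (*-distribˡ-sum 2ℤ (𝟙 ∘ isMinus)) ⟨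
    + dout d v + 2ℤ * sum (𝟙 ∘ isMinus)
      ≡⟨ cong (λ z → + dout d v + 2ℤ * z) (+count≡sum isMinus) ⟨
    + dout d v + 2ℤ * + η⁺ L v
      ∎
    where
    isNonzero isTwo isMinus : Fin n → Bool
    isNonzero w = not (L v w =ᶻ 0ℤ)
    isTwo w = L v w =ᶻ 2ℤ
    isMinus w = L v w =ᶻ -1ℤ

module DegreeBounds {n} {d : DegSeq n} {L : Matrix n} (enc : IsEncoding d L) (ρ : ℕ)
                    (din≤ρ : ∀ v → din d v ≤ ρ) (dout≤ρ : ∀ v → dout d v ≤ ρ) where
  open RowSums enc
  private module Cols = RowSums (IsEncoding-transpose enc)

  onesFrom-≤ : ∀ v → onesFrom L v ℤ.≤ + ρ + (+ η⁺ L v - 2ℤ * + ζ⁺ L v)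
  onesFrom-≤ v = balance⇒≤ {e = + η⁺ L v} (onesFrom-balance v) (ℤ.+≤+ (dout≤ρ v))

  inNeighbours-≤ : ∀ v → sum (𝟙 ∘ inN⁻ L v) ℤ.≤ + ρ + (2ℤ * + η⁻ L v - + ζ⁻ L v)
  inNeighbours-≤ v = ℤP.≤-trans
    (sum-mono-≤ (λ u → 𝟙-∧-≤ (u ≠ᶠ v) (not (L u v =ᶻ 0ℤ))))
    (balance⇒≤ {e = 2ℤ * + η⁻ L v} (Cols.nonzeroFrom-balance v) (ℤ.+≤+ (din≤ρ v)))

  #-tail-at-≤ : ∀ v →
    #[ (λ i j → ⌊ i ≟ v ⌋) ∩ isOne L ] ℤ.≤ + ρ + (+ η⁺ L v - 2ℤ * + ζ⁺ L v)
  #-tail-at-≤ v = ℤP.≤-trans (ℤP.≤-reflexive (#-tail-at v (isOne L))) (onesFrom-≤ v)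

  #-tail-in-N⁻-≤ : ∀ v →
    #[ (λ i j → inN⁻ L v i) ∩ isOne L ] ℤ.≤ + ρ * (+ ρ + (2ℤ * + η⁻ L v - + ζ⁻ L v)) + sumIn L v
  #-tail-in-N⁻-≤ v = begin
    #[ (λ i j → inN⁻ L v i) ∩ isOne L ]  ≡⟨ #-tail-restricted (inN⁻ L v) (isOne L) ⟩
    sum (λ i → if inN⁻ L v i then onesFrom L i else 0ℤ)
      ≤⟨ sum-if-≤ ρ (inN⁻ L v) onesFrom-≤ (inNeighbours-≤ v) ⟩
    + ρ * K + sum weights                ≡⟨ cong (_+_ (+ ρ * K)) (sumℤ≡sum weights) ⟨
    + ρ * K + sumIn L v                  ∎
    where
    open ℤP.≤-Reasoning
    K : ℤ
    K = + ρ + (2ℤ * + η⁻ L v - + ζ⁻ L v)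
    weights : Fin n → ℤ
    weights y = if inN⁻ L v y then + η⁺ L y - 2ℤ * + ζ⁺ L y else 0ℤ

≤-maxℕ : ∀ {n} (f : Fin n → ℕ) i → f i ≤ maxℕ f
≤-maxℕ f zero    = ℕP.m≤m⊔n _ _
≤-maxℕ f (suc i) = ℕP.≤-trans (≤-maxℕ (f ∘ suc) i) (ℕP.m≤n⊔m _ _)

din≤rmax : ∀ {n} (d : DegSeq n) v → din d v ≤ rmax d
din≤rmax d v =
  ℕP.≤-trans (ℕP.m≤m⊔n (din d v) (dout d v)) (≤-maxℕ (λ j → din d j ℕ.⊔ dout d j) v)

dout≤rmax : ∀ {n} (d : DegSeq n) v → dout d v ≤ rmax d
dout≤rmax d v =
  ℕP.≤-trans (ℕP.m≤n⊔m (din d v) (dout d v)) (≤-maxℕ (λ j → din d j ℕ.⊔ dout d j) v)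

≢-by-0≢1 : ∀ {n} (f : Fin n → ℤ) {x y} → f x ≡ 0ℤ → f y ≡ 1ℤ → x ≢ y
≢-by-0≢1 f fx≡0 fy≡1 x≡y with () ← trans (sym fx≡0) (trans (cong f x≡y) fy≡1)

≢-by-≢0 : ∀ {n} (f : Fin n → ℤ) {x y} → f x ≢ 0ℤ → f y ≡ 0ℤ → x ≢ y
≢-by-≢0 f fx≢0 fy≡0 x≡y = fx≢0 (trans (cong f x≡y) fy≡0)

module Counting {n} {d : DegSeq n} {L : Matrix n} (enc : IsEncoding d L) where
  open RowSums enc
  open DegreeBounds enc (rmax d) (din≤rmax d) (dout≤rmax d)
  private
    module ᵀ = DegreeBounds (IsEncoding-transpose enc) (rmax d) (dout≤rmax d) (din≤rmax d)
    diag : ∀ i → L i i ≡ 0ℤ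
    diag = proj₁ (proj₂ enc)

  R : ℤ
  R = + rmax d

  #-head-at-≤ : ∀ v →
    #[ (λ i j → ⌊ j ≟ v ⌋) ∩ isOne L ] ℤ.≤ R + (+ η⁻ L v - 2ℤ * + ζ⁻ L v)
  #-head-at-≤ v = ℤP.≤-trans (ℤP.≤-reflexive (#-transpose ((λ i j → ⌊ j ≟ v ⌋) ∩ isOne L)))
                             (ᵀ.#-tail-at-≤ v)

  #-head-in-N⁺-≤ : ∀ v →
    #[ (λ i j → inN⁺ L v j) ∩ isOne L ] ℤ.≤ R * (R + (2ℤ * + η⁺ L v - + ζ⁺ L v)) + sumOut L v
  #-head-in-N⁺-≤ v = ℤP.≤-trans (ℤP.≤-reflexive (#-transpose ((λ i j → inN⁺ L v j) ∩ isOne L)))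
                                (ᵀ.#-tail-in-N⁻-≤ v)

  #ones-balance : #[ isOne L ] + 2ℤ * + nTwo L ≡ + mOf d + + nMinus L
  #ones-balance = begin
    sum (onesFrom L) + 2ℤ * + nTwo L
      ≡⟨ cong (λ z → sum (onesFrom L) + 2ℤ * z) (+sumℕ≡sum (ζ⁺ L)) ⟩
    sum (onesFrom L) + 2ℤ * sum (λ v → + ζ⁺ L v)
      ≡⟨ cong (_+_ (sum (onesFrom L))) (*-distribˡ-sum 2ℤ (λ v → + ζ⁺ L v)) ⟩
    sum (onesFrom L) + sum (λ v → 2ℤ * + ζ⁺ L v)
      ≡⟨ ∑-distrib-+ (onesFrom L) (λ v → 2ℤ * + ζ⁺ L v) ⟨
    sum (λ v → onesFrom L v + 2ℤ * + ζ⁺ L v)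
      ≡⟨ sum-cong-≗ onesFrom-balance ⟩
    sum (λ v → + dout d v + + η⁺ L v)
      ≡⟨ ∑-distrib-+ (λ v → + dout d v) (λ v → + η⁺ L v) ⟩
    sum (λ v → + dout d v) + sum (λ v → + η⁺ L v)
      ≡⟨ cong₂ _+_ (+sumℕ≡sum (dout d)) (+sumℕ≡sum (η⁺ L)) ⟨
    + mOf d + + nMinus L
      ∎
    where open ≡-Reasoning

  excludedI : (a₁ b₁ : Fin n) → List (PairPred n)
  excludedI a₁ b₁ = (λ i j → inN⁻ L b₁ i) ∷ (λ i j → ⌊ j ≟ a₁ ⌋) ∷ (λ i j → ⌊ i ≟ b₁ ⌋) ∷ []

  countI-cover : ∀ {a₁ b₁} → a₁ ≢ b₁ → L a₁ b₁ ≢ 0ℤ → ∀ i j → T (isOne L i j) →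
    T ((L i j =ᶻ 1ℤ) ∧ (L i b₁ =ᶻ 0ℤ) ∧ distinctᵇ (a₁ ∷ b₁ ∷ i ∷ j ∷ [])) ⊎
    Any (λ C → T (C i j)) (excludedI a₁ b₁)
  countI-cover {a₁} {b₁} a₁≢b₁ La₁b₁≢0 i j one with i ≟ b₁ | L i b₁ ℤ.≟ 0ℤ | j ≟ a₁
  ... | yes i≡b₁ | _          | _        = inj₂ (there (there (here (fromWitness i≡b₁))))
  ... | no i≢b₁  | no Lib₁≢0  | _        = inj₂ (here (Equivalence.from (T-∧ {i ≠ᶠ b₁})
                                             (fromWitnessFalse i≢b₁ , fromWitnessFalse Lib₁≢0)))
  ... | no _     | yes _      | yes j≡a₁ = inj₂ (there (here (fromWitness j≡a₁)))
  -- the `with` has already turned the test L i b₁ =ᶻ 0ℤ in the goal into true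
  ... | no i≢b₁  | yes Lib₁≡0 | no j≢a₁  =
    inj₁ (Equivalence.from (T-∧ {L i j =ᶻ 1ℤ}) (one , distinctᵇ-Unique distinct))
    where
    Lij≡1 : L i j ≡ 1ℤ
    Lij≡1 = toWitness one
    distinct : Unique (a₁ ∷ b₁ ∷ i ∷ j ∷ [])
    distinct = (a₁≢b₁ ∷ ≢-by-≢0 (λ k → L k b₁) La₁b₁≢0 Lib₁≡0 ∷ j≢a₁ ∘ sym ∷ [])
             ∷ (i≢b₁ ∘ sym ∷ ≢-by-0≢1 (L i) Lib₁≡0 Lij≡1 ∷ [])
             ∷ (≢-by-0≢1 (L i) (diag i) Lij≡1 ∷ [])
             ∷ [] ∷ []

  countI-lower-bound : ∀ {a₁ b₁} → a₁ ≢ b₁ → L a₁ b₁ ≢ 0ℤ →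
    boundI d L (nTwo L) (nMinus L) a₁ b₁ ℤ.≤ + countI L a₁ b₁
  countI-lower-bound {a₁} {b₁} a₁≢b₁ La₁b₁≢0 =
    count-lower-bound {m = + mOf d} {p = + nTwo L} {q = + nMinus L} #ones-balance
      (#-cover _ (isOne L) (excludedI a₁ b₁) (countI-cover a₁≢b₁ La₁b₁≢0))
      (ℤP.≤-trans
        (ℤP.+-mono-≤ (#-tail-in-N⁻-≤ b₁)
        (ℤP.+-mono-≤ (#-head-at-≤ a₁) (ℤP.+-mono-≤ (#-tail-at-≤ b₁) ℤP.≤-refl)))
        (ℤP.≤-reflexive (regroup R (+ ζ⁻ L b₁) (+ η⁻ L b₁) (sumIn L b₁)
                                 (+ η⁻ L a₁) (+ ζ⁻ L a₁) (+ η⁺ L b₁) (+ ζ⁺ L b₁))))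
    where
    regroup : ∀ ρ z e σ e₁ z₁ e₂ z₂ →
      ρ * (ρ + (2ℤ * e - z)) + σ + ((ρ + (e₁ - 2ℤ * z₁)) + ((ρ + (e₂ - 2ℤ * z₂)) + 0ℤ))
        ≡ ρ * (ρ - z + 2ℤ * e + 2ℤ) + e₁ + e₂ - 2ℤ * (z₁ + z₂) + σ
    regroup = solve-∀

  excludedII : (a₁ a₂ b₁ b₂ : Fin n) → List (PairPred n)
  excludedII a₁ a₂ b₁ b₂ =
    (λ i j → inN⁺ L a₁ j) ∷ (λ i j → inN⁻ L b₂ i) ∷ (λ i j → ⌊ j ≟ a₁ ⌋) ∷ (λ i j → ⌊ j ≟ a₂ ⌋) ∷
    (λ i j → ⌊ i ≟ b₁ ⌋) ∷ (λ i j → ⌊ i ≟ b₂ ⌋) ∷ []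

  countII-cover : ∀ {a₁ b₁ a₂ b₂} → Unique (a₁ ∷ b₁ ∷ a₂ ∷ b₂ ∷ []) →
    L a₁ b₁ ≢ 0ℤ → L a₂ b₂ ≡ 1ℤ → ∀ i j → T (isOne L i j) →
    T ((L i j =ᶻ 1ℤ) ∧ (L a₁ j =ᶻ 0ℤ) ∧ (L i b₂ =ᶻ 0ℤ) ∧
       distinctᵇ (a₁ ∷ b₁ ∷ a₂ ∷ b₂ ∷ i ∷ j ∷ [])) ⊎
    Any (λ C → T (C i j)) (excludedII a₁ a₂ b₁ b₂)
  countII-cover {a₁} {b₁} {a₂} {b₂}
    ((a₁≢b₁ ∷ a₁≢a₂ ∷ a₁≢b₂ ∷ []) ∷ (b₁≢a₂ ∷ b₁≢b₂ ∷ []) ∷ (a₂≢b₂ ∷ []) ∷ [] ∷ [])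
    La₁b₁≢0 La₂b₂≡1 i j one
    with j ≟ a₁ | j ≟ a₂ | i ≟ b₁ | i ≟ b₂ | L a₁ j ℤ.≟ 0ℤ | L i b₂ ℤ.≟ 0ℤ
  ... | yes j≡a₁ | _ | _ | _ | _ | _ = inj₂ (there (there (here (fromWitness j≡a₁))))
  ... | no _ | yes j≡a₂ | _ | _ | _ | _ = inj₂ (there (there (there (here (fromWitness j≡a₂)))))
  ... | no _ | no _ | yes i≡b₁ | _ | _ | _ =
    inj₂ (there (there (there (there (here (fromWitness i≡b₁))))))
  ... | no _ | no _ | no _ | yes i≡b₂ | _ | _ =
    inj₂ (there (there (there (there (there (here (fromWitness i≡b₂)))))))
  ... | no j≢a₁ | no _ | no _ | no _ | no La₁j≢0 | _ =
    inj₂ (here (Equivalence.from (T-∧ {j ≠ᶠ a₁})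
                  (fromWitnessFalse j≢a₁ , fromWitnessFalse La₁j≢0)))
  ... | no _ | no _ | no _ | no i≢b₂ | yes _ | no Lib₂≢0 =
    inj₂ (there (here (Equivalence.from (T-∧ {i ≠ᶠ b₂})
                         (fromWitnessFalse i≢b₂ , fromWitnessFalse Lib₂≢0))))
  -- as in countI-cover, the two tests for 0 have become true in the goal
  ... | no j≢a₁ | no j≢a₂ | no i≢b₁ | no i≢b₂ | yes La₁j≡0 | yes Lib₂≡0 =
    inj₁ (Equivalence.from (T-∧ {L i j =ᶻ 1ℤ}) (one , distinctᵇ-Unique distinct))
    where
    Lij≡1 : L i j ≡ 1ℤ
    Lij≡1 = toWitness one
    distinct : Unique (a₁ ∷ b₁ ∷ a₂ ∷ b₂ ∷ i ∷ j ∷ [])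
    distinct =
        (a₁≢b₁ ∷ a₁≢a₂ ∷ a₁≢b₂ ∷ ≢-by-0≢1 (λ k → L k j) La₁j≡0 Lij≡1 ∷ j≢a₁ ∘ sym ∷ [])
      ∷ (b₁≢a₂ ∷ b₁≢b₂ ∷ i≢b₁ ∘ sym ∷ ≢-by-≢0 (L a₁) La₁b₁≢0 La₁j≡0 ∷ [])
      ∷ (a₂≢b₂ ∷ ≢-by-0≢1 (λ k → L k b₂) Lib₂≡0 La₂b₂≡1 ∘ sym ∷ j≢a₂ ∘ sym ∷ [])
      ∷ (i≢b₂ ∘ sym ∷ ≢-by-0≢1 (L i) Lib₂≡0 Lij≡1 ∷ [])
      ∷ (≢-by-0≢1 (L i) (diag i) Lij≡1 ∷ [])
      ∷ [] ∷ []

  countII-lower-bound : ∀ {a₁ b₁ a₂ b₂} → Unique (a₁ ∷ b₁ ∷ a₂ ∷ b₂ ∷ []) →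
    L a₁ b₁ ≢ 0ℤ → L a₂ b₂ ≡ 1ℤ →
    boundII d L (nTwo L) (nMinus L) a₁ b₁ a₂ b₂ ℤ.≤ + countII L a₁ b₁ a₂ b₂
  countII-lower-bound {a₁} {b₁} {a₂} {b₂} unique La₁b₁≢0 La₂b₂≡1 =
    count-lower-bound {m = + mOf d} {p = + nTwo L} {q = + nMinus L} #ones-balance
      (#-cover _ (isOne L) (excludedII a₁ a₂ b₁ b₂) (countII-cover unique La₁b₁≢0 La₂b₂≡1))
      (ℤP.≤-trans
        (ℤP.+-mono-≤ (#-head-in-N⁺-≤ a₁) (ℤP.+-mono-≤ (#-tail-in-N⁻-≤ b₂)
        (ℤP.+-mono-≤ (#-head-at-≤ a₁) (ℤP.+-mono-≤ (#-head-at-≤ a₂)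
        (ℤP.+-mono-≤ (#-tail-at-≤ b₁) (ℤP.+-mono-≤ (#-tail-at-≤ b₂) ℤP.≤-refl))))))
        (ℤP.≤-reflexive (trans
          (regroup R (+ ζ⁺ L a₁) (+ η⁺ L a₁) (sumOut L a₁)
                   (+ ζ⁻ L b₂) (+ η⁻ L b₂) (sumIn L b₂)
                   (+ η⁻ L a₁) (+ ζ⁻ L a₁) (+ η⁻ L a₂) (+ ζ⁻ L a₂)
                   (+ η⁺ L b₁) (+ ζ⁺ L b₁) (+ η⁺ L b₂) (+ ζ⁺ L b₂))
          (cong₂ (λ E Z → R * (2ℤ * R - (+ ζ⁺ L a₁ + + ζ⁻ L b₂)
                                   + 2ℤ * (+ η⁺ L a₁ + + η⁻ L b₂) + + 4)
                          + E - 2ℤ * Z + sumOut L a₁ + sumIn L b₂)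
                 (sym (pos-+₄ (η⁻ L a₁) (η⁺ L b₁) (η⁻ L a₂) (η⁺ L b₂)))
                 (sym (pos-+₄ (ζ⁻ L a₁) (ζ⁺ L b₁) (ζ⁻ L a₂) (ζ⁺ L b₂)))))))
    where
    pos-+₄ : ∀ w x y z → + (w ℕ.+ x ℕ.+ y ℕ.+ z) ≡ + w + + x + + y + + z
    pos-+₄ w x y z = trans (ℤP.pos-+ (w ℕ.+ x ℕ.+ y) z)
      (cong (_+ + z) (trans (ℤP.pos-+ (w ℕ.+ x) y) (cong (_+ + y) (ℤP.pos-+ w x))))
    regroup : ∀ ρ zₐ eₐ σₐ z_b e_b σ_b e₁ z₁ e₂ z₂ e₃ z₃ e₄ z₄ →
      ρ * (ρ + (2ℤ * eₐ - zₐ)) + σₐ + (ρ * (ρ + (2ℤ * e_b - z_b)) + σ_b +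
        ((ρ + (e₁ - 2ℤ * z₁)) + ((ρ + (e₂ - 2ℤ * z₂)) +
        ((ρ + (e₃ - 2ℤ * z₃)) + ((ρ + (e₄ - 2ℤ * z₄)) + 0ℤ)))))
        ≡ ρ * (2ℤ * ρ - (zₐ + z_b) + 2ℤ * (eₐ + e_b) + + 4)
          + (e₁ + e₃ + e₂ + e₄) - 2ℤ * (z₁ + z₃ + z₂ + z₄) + σₐ + σ_b
    regroup = solve-∀

lemma3p5 : ∀ {n} (d : DegSeq n) (Z L : Matrix n) (p q : ℕ) →
    InΩ d Z → p ≤ 3 → q ≤ 3 → InC d Z p q L →
    (a₁ b₁ : Fin n) → a₁ ≢ b₁ → L a₁ b₁ ≢ 0ℤ →
    (boundI d L p q a₁ b₁ ℤ.≤ + countI L a₁ b₁) ×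
    (∀ (a₂ b₂ : Fin n) → Unique (a₁ ∷ b₁ ∷ a₂ ∷ b₂ ∷ []) → L a₂ b₂ ≡ 1ℤ →
      boundII d L p q a₁ b₁ a₂ b₂ ℤ.≤ + countII L a₁ b₁ a₂ b₂)
lemma3p5 d Z L _ _ _ _ _ (enc , _ , _ , refl , refl) a₁ b₁ a₁≢b₁ La₁b₁≢0 =
  countI-lower-bound a₁≢b₁ La₁b₁≢0 ,
  λ a₂ b₂ unique La₂b₂≡1 → countII-lower-bound unique La₁b₁≢0 La₂b₂≡1
  where open Counting enc
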